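{- Let $w$ be a binary word over $\{0,1\}$ and $u$ a factor of $w$. Then $\mathrm{RC}(u)\preceq\mathrm{RC}(w)$, $|\mathrm{RC}(u)|=|u|+3$, and $\ell(\mathrm{RC}(u))=|u|_1+2$.
   Context: A caterpillar sequence is a finite sequence $S=(s_1,\dots,s_k)$, $k\ge1$, of non-negative integers with $s_1,s_k\ge1$, and $s_1\ge2$ if $k=1$; its size is $|S|=k+\sum_j s_j$ and its number of leaves is $\ell(S)=\sum_j s_j$. Let $f(S)=(s_1)$ if $k=1$ and $f(S)=(s_1+1,s_2+2,\dots,s_{k-1}+2,s_k+1)$ if $k>1$; for $S'$ of length $k'$ and $S$ of length $k$, $S'\preceq S$ means $k'\le k$ and there exists $i\in\{0,\dots,k-k'\}$ with $f(S')[j]\le f(S)[j+i]$ for $1\le j\le k'$. The reading caterpillar sequence: $\mathrm{RC}(\varepsilon)=(2)$ and, if $\mathrm{RC}(v)=(r_1,\dots,r_k)$, $\mathrm{RC}(v0)=(r_1,\dots,r_{k-1},r_k-1,1)$, $\mathrm{RC}(v1)=(r_1,\dots,r_{k-1},r_k+1)$. $|u|_1$ is the number of $1$'s in $u$. -}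

module Defs where

open import Data.Nat using (ℕ; zero; suc; _+_; _∸_; _≤_)
open import Data.Bool using (Bool; true; false)
open import Data.List using (List; []; _∷_; _++_; length; foldl; drop)
open import Data.Nat.ListAction using (sum)
open import Data.Product using (Σ; _×_; ∃-syntax)
open import Relation.Binary.PropositionalEquality using (_≡_)

Seq : Set
Seq = List ℕ

data IsCaterpillar : Seq → Set where
  single : ∀ s → 2 ≤ s → IsCaterpillar (s ∷ [])
  multi  : ∀ s₁ mid sₖ → 1 ≤ s₁ → 1 ≤ sₖ → IsCaterpillar (s₁ ∷ mid ++ (sₖ ∷ []))

size : Seq → ℕ
size S = length S + sum S

leaves : Seq → ℕ
leaves S = sum S

fTail : Seq → Seq
fTail []           = []
fTail (x ∷ [])     = suc x ∷ []
fTail (x ∷ y ∷ xs) = suc (suc x) ∷ fTail (y ∷ xs)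

f : Seq → Seq
f []           = []
f (x ∷ [])     = x ∷ []
f (x ∷ y ∷ xs) = suc x ∷ fTail (y ∷ xs)

data PrefixLe : Seq → Seq → Set where
  []  : ∀ {ys} → PrefixLe [] ys
  _∷_ : ∀ {x y xs ys} → x ≤ y → PrefixLe xs ys → PrefixLe (x ∷ xs) (y ∷ ys)

_⪯_ : Seq → Seq → Set
S' ⪯ S = length S' ≤ length S ×
         ∃[ i ] (i ≤ length S ∸ length S' × PrefixLe (f S') (drop i (f S)))

-- one step of the reading caterpillar sequence, appending a letter (false = 0, true = 1)
-- acting on the last entry of the sequence
stepLast : Bool → Seq → Seq
stepLast b []             = []
stepLast false (r ∷ [])   = (r ∸ 1) ∷ 1 ∷ []
stepLast true  (r ∷ [])   = suc r ∷ []
stepLast b (r ∷ s ∷ rs)   = r ∷ stepLast b (s ∷ rs)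

RC : List Bool → Seq
RC w = foldl (λ S b → stepLast b S) (2 ∷ []) w

count1 : List Bool → ℕ
count1 []          = 0
count1 (true ∷ u)  = suc (count1 u)
count1 (false ∷ u) = count1 u

Factor : List Bool → List Bool → Set
Factor u w = ∃[ x ] ∃[ y ] (w ≡ x ++ u ++ y)

-- Write w = 1^a₀ 0 1^a₁ 0 ⋯ 0 1^aₖ. Then RC w = (a₀+1, a₁, …, aₖ₋₁, aₖ+1) (or (a₀+2) when
-- k = 0), so f (RC w) = (a₀+2, …, aₖ+2): the order ⪯ only compares run lengths of 1's.
-- Appending letters to a word only lengthens its runs or adds new ones, and the runs of x ++ u
-- are those of x followed by those of u, with the last run of x merged into the first run of u.
-- Hence the runs of a factor u embed, entry-wise dominated, into the runs of w.  Every letter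
-- adds one to the size and every 1 adds one leaf, starting from size 3 and 2 leaves for RC ε.
module Submission where

open import Defs
open import Data.Nat using (ℕ; suc; z≤n; s≤s; _+_; _≤_)
open import Data.Nat.Properties
  using (≤-refl; ≤-trans; n≤1+n; m≤m+n; m≤n+m; +-suc; +-comm; +-assoc; +-identityʳ;
         +-monoʳ-≤; m+n≤o⇒m≤o∸n; +-commutativeSemigroup)
open import Algebra.Properties.CommutativeSemigroup +-commutativeSemigroup using (interchange)
open import Data.Bool using (Bool; true; false)
open import Data.List using (List; []; _∷_; _++_; _∷ʳ_; length; foldl; drop; map)
open import Data.List.Properties using (++-assoc; length-++; foldl-++; drop-map)
open import Data.Nat.ListAction using (sum)
open import Data.Nat.ListAction.Properties using (sum-++)
open import Data.Product using (_×_; _,_; proj₁; proj₂)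
open import Relation.Binary.Core using (_Preserves_⟶_)
open import Relation.Binary.PropositionalEquality
  using (_≡_; refl; sym; trans; cong; subst; subst₂; cong₂; module ≡-Reasoning)

PrefixLe-refl : ∀ xs → PrefixLe xs xs
PrefixLe-refl []       = []
PrefixLe-refl (x ∷ xs) = ≤-refl ∷ PrefixLe-refl xs

PrefixLe-trans : ∀ {xs ys zs} → PrefixLe xs ys → PrefixLe ys zs → PrefixLe xs zs
PrefixLe-trans []       _        = []
PrefixLe-trans (p ∷ ps) (q ∷ qs) = ≤-trans p q ∷ PrefixLe-trans ps qs

PrefixLe-++ˡ : ∀ zs {xs ys} → PrefixLe xs ys → PrefixLe (zs ++ xs) (zs ++ ys)
PrefixLe-++ˡ []       p = p
PrefixLe-++ˡ (z ∷ zs) p = ≤-refl ∷ PrefixLe-++ˡ zs p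

PrefixLe-++ʳ : ∀ xs ys → PrefixLe xs (xs ++ ys)
PrefixLe-++ʳ []       ys = []
PrefixLe-++ʳ (x ∷ xs) ys = ≤-refl ∷ PrefixLe-++ʳ xs ys

PrefixLe-drop : ∀ zs {xs ys} → PrefixLe (zs ++ xs) ys → PrefixLe xs (drop (length zs) ys)
PrefixLe-drop []       p        = p
PrefixLe-drop (z ∷ zs) (_ ∷ ps) = PrefixLe-drop zs ps

PrefixLe-length : ∀ {xs ys} → PrefixLe xs ys → length xs ≤ length ys
PrefixLe-length []       = z≤n
PrefixLe-length (p ∷ ps) = s≤s (PrefixLe-length ps)

PrefixLe-map : ∀ {g} → g Preserves _≤_ ⟶ _≤_ →
               ∀ {xs ys} → PrefixLe xs ys → PrefixLe (map g xs) (map g ys)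
PrefixLe-map mono []       = []
PrefixLe-map mono (p ∷ ps) = mono p ∷ PrefixLe-map mono ps

⪯-intro : ∀ {S′ S} i → i + length S′ ≤ length S → PrefixLe (f S′) (drop i (f S)) → S′ ⪯ S
⪯-intro {S′} i bound p = ≤-trans (m≤n+m (length S′) i) bound , i , m+n≤o⇒m≤o∸n i bound , p

size-++ : ∀ xs ys → size (xs ++ ys) ≡ size xs + size ys
size-++ xs ys = begin
  length (xs ++ ys) + sum (xs ++ ys)               ≡⟨ cong₂ _+_ (length-++ xs) (sum-++ xs ys) ⟩
  (length xs + length ys) + (sum xs + sum ys)      ≡⟨ interchange (length xs) (length ys) (sum xs) (sum ys) ⟩
  (length xs + sum xs) + (length ys + sum ys)      ∎
  where open ≡-Reasoning

-- Runs of 1's: (S , a) lists the completed runs S (each closed by a 0) and the current run a.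
Runs : Set
Runs = List ℕ × ℕ

runsList : Runs → List ℕ
runsList (S , a) = S ∷ʳ a

push : Bool → Runs → Runs
push true  (S , a) = S , suc a
push false (S , a) = S ∷ʳ a , 0

runsFrom : Runs → List Bool → Runs
runsFrom = foldl (λ X b → push b X)

runs : List Bool → Runs
runs = runsFrom ([] , 0)

caterpillar : Runs → Seq
caterpillar ([]    , a) = suc (suc a) ∷ []
caterpillar (s ∷ S , a) = suc s ∷ (S ∷ʳ suc a)

stepLast-∷ʳ : ∀ b T r → stepLast b (T ∷ʳ r) ≡ T ++ stepLast b (r ∷ [])
stepLast-∷ʳ b     []          r = refl
stepLast-∷ʳ true  (t ∷ [])    r = refl
stepLast-∷ʳ false (t ∷ [])    r = refl
stepLast-∷ʳ true  (t ∷ u ∷ T) r = cong (t ∷_) (stepLast-∷ʳ true (u ∷ T) r)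
stepLast-∷ʳ false (t ∷ u ∷ T) r = cong (t ∷_) (stepLast-∷ʳ false (u ∷ T) r)

stepLast-caterpillar : ∀ b X → stepLast b (caterpillar X) ≡ caterpillar (push b X)
stepLast-caterpillar true  ([]    , a) = refl
stepLast-caterpillar false ([]    , a) = refl
stepLast-caterpillar true  (s ∷ S , a) = stepLast-∷ʳ true (suc s ∷ S) (suc a)
stepLast-caterpillar false (s ∷ S , a) =
  trans (stepLast-∷ʳ false (suc s ∷ S) (suc a)) (cong (suc s ∷_) (sym (++-assoc S (a ∷ []) (1 ∷ []))))

RC-caterpillar : ∀ w → RC w ≡ caterpillar (runs w)
RC-caterpillar = go ([] , 0)
  where
  go : ∀ X w → foldl (λ S b → stepLast b S) (caterpillar X) w ≡ caterpillar (runsFrom X w)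
  go X []      = refl
  go X (b ∷ w) = trans (cong (λ T → foldl (λ S b → stepLast b S) T w) (stepLast-caterpillar b X))
                       (go (push b X) w)

fTail-∷ʳ : ∀ T r → fTail (T ∷ʳ suc r) ≡ map (2 +_) (T ∷ʳ r)
fTail-∷ʳ []          r = refl
fTail-∷ʳ (t ∷ [])    r = refl
fTail-∷ʳ (t ∷ u ∷ T) r = cong (2 + t ∷_) (fTail-∷ʳ (u ∷ T) r)

f-caterpillar : ∀ X → f (caterpillar X) ≡ map (2 +_) (runsList X)
f-caterpillar ([]        , a) = refl
f-caterpillar (s ∷ []    , a) = refl
f-caterpillar (s ∷ t ∷ S , a) = cong (2 + s ∷_) (fTail-∷ʳ (t ∷ S) a)

length-caterpillar : ∀ X → length (caterpillar X) ≡ length (runsList X)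
length-caterpillar ([]    , a) = refl
length-caterpillar (s ∷ S , a) = cong suc (trans (length-++ S) (sym (length-++ S)))

sum-∷ʳ-suc : ∀ T r → sum (T ∷ʳ suc r) ≡ suc (sum (T ∷ʳ r))
sum-∷ʳ-suc []      r = refl
sum-∷ʳ-suc (t ∷ T) r = trans (cong (t +_) (sum-∷ʳ-suc T r)) (+-suc t _)

leaves-caterpillar : ∀ X → leaves (caterpillar X) ≡ leaves (runsList X) + 2
leaves-caterpillar ([]    , a) = +-comm 2 (a + 0)
leaves-caterpillar (s ∷ S , a) =
  trans (cong (suc s +_) (sum-∷ʳ-suc S a)) (trans (cong suc (+-suc s _)) (+-comm 2 _))

size-caterpillar : ∀ X → size (caterpillar X) ≡ size (runsList X) + 2
size-caterpillar X = begin
  length (caterpillar X) + sum (caterpillar X)        ≡⟨ cong₂ _+_ (length-caterpillar X) (leaves-caterpillar X) ⟩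
  length (runsList X) + (sum (runsList X) + 2)        ≡⟨ sym (+-assoc (length (runsList X)) _ 2) ⟩
  size (runsList X) + 2                               ∎
  where open ≡-Reasoning

size-push : ∀ b X → size (runsList (push b X)) ≡ suc (size (runsList X))
size-push true  (S , a) =
  trans (size-++ S (suc a ∷ [])) (trans (+-suc (size S) _) (cong suc (sym (size-++ S (a ∷ [])))))
size-push false (S , a) = trans (size-++ (S ∷ʳ a) (0 ∷ [])) (+-comm _ 1)

leaves-push-true : ∀ X → leaves (runsList (push true X)) ≡ suc (leaves (runsList X))
leaves-push-true (S , a) = sum-∷ʳ-suc S a

leaves-push-false : ∀ X → leaves (runsList (push false X)) ≡ leaves (runsList X)
leaves-push-false (S , a) = trans (sum-++ (S ∷ʳ a) (0 ∷ [])) (+-identityʳ _)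

size-runsFrom : ∀ X u → size (runsList (runsFrom X u)) ≡ length u + size (runsList X)
size-runsFrom X []      = refl
size-runsFrom X (b ∷ u) =
  trans (size-runsFrom (push b X) u) (trans (cong (length u +_) (size-push b X)) (+-suc (length u) _))

leaves-runsFrom : ∀ X u → leaves (runsList (runsFrom X u)) ≡ count1 u + leaves (runsList X)
leaves-runsFrom X []          = refl
leaves-runsFrom X (true ∷ u)  =
  trans (leaves-runsFrom (push true X) u) (trans (cong (count1 u +_) (leaves-push-true X)) (+-suc (count1 u) _))
leaves-runsFrom X (false ∷ u) =
  trans (leaves-runsFrom (push false X) u) (cong (count1 u +_) (leaves-push-false X))

size-RC : ∀ u → size (RC u) ≡ length u + 3
size-RC u = begin
  size (RC u)                             ≡⟨ cong size (RC-caterpillar u) ⟩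
  size (caterpillar (runs u))             ≡⟨ size-caterpillar (runs u) ⟩
  size (runsList (runs u)) + 2            ≡⟨ cong (_+ 2) (size-runsFrom ([] , 0) u) ⟩
  length u + 1 + 2                        ≡⟨ +-assoc (length u) 1 2 ⟩
  length u + 3                            ∎
  where open ≡-Reasoning

leaves-RC : ∀ u → leaves (RC u) ≡ count1 u + 2
leaves-RC u = begin
  leaves (RC u)                           ≡⟨ cong leaves (RC-caterpillar u) ⟩
  leaves (caterpillar (runs u))           ≡⟨ leaves-caterpillar (runs u) ⟩
  leaves (runsList (runs u)) + 2          ≡⟨ cong (_+ 2) (leaves-runsFrom ([] , 0) u) ⟩
  count1 u + 0 + 2                        ≡⟨ cong (_+ 2) (+-identityʳ (count1 u)) ⟩
  count1 u + 2                            ∎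
  where open ≡-Reasoning

PrefixLe-push : ∀ b X → PrefixLe (runsList X) (runsList (push b X))
PrefixLe-push true  (S , a) = PrefixLe-++ˡ S (n≤1+n a ∷ [])
PrefixLe-push false (S , a) = PrefixLe-++ʳ (S ∷ʳ a) (0 ∷ [])

PrefixLe-runsFrom : ∀ X u → PrefixLe (runsList X) (runsList (runsFrom X u))
PrefixLe-runsFrom X []      = PrefixLe-refl (runsList X)
PrefixLe-runsFrom X (b ∷ u) = PrefixLe-trans (PrefixLe-push b X) (PrefixLe-runsFrom (push b X) u)

-- The runs of x ++ u, where runs x = (S , a): the current run a of x continues the first run of u.
prependRuns : List ℕ → ℕ → Runs → Runs
prependRuns S a ([]    , b) = S , b + a
prependRuns S a (t ∷ T , b) = S ++ t + a ∷ T , b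

push-prependRuns : ∀ b S a X → push b (prependRuns S a X) ≡ prependRuns S a (push b X)
push-prependRuns true  S a ([]    , b) = refl
push-prependRuns false S a ([]    , b) = refl
push-prependRuns true  S a (t ∷ T , b) = refl
push-prependRuns false S a (t ∷ T , b) = cong (_, 0) (++-assoc S (t + a ∷ T) (b ∷ []))

runsFrom-prependRuns : ∀ S a X u → runsFrom (prependRuns S a X) u ≡ prependRuns S a (runsFrom X u)
runsFrom-prependRuns S a X []      = refl
runsFrom-prependRuns S a X (b ∷ u) =
  trans (cong (λ Y → runsFrom Y u) (push-prependRuns b S a X)) (runsFrom-prependRuns S a (push b X) u)

runs-++ : ∀ x u → runs (x ++ u) ≡ prependRuns (proj₁ (runs x)) (proj₂ (runs x)) (runs u)
runs-++ x u = trans (foldl-++ _ ([] , 0) x u) (runsFrom-prependRuns (proj₁ (runs x)) (proj₂ (runs x)) ([] , 0) u)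

PrefixLe-prependRuns : ∀ S a X → PrefixLe (S ++ runsList X) (runsList (prependRuns S a X))
PrefixLe-prependRuns S a ([]    , b) = PrefixLe-++ˡ S (m≤m+n b a ∷ [])
PrefixLe-prependRuns S a (t ∷ T , b) =
  subst (PrefixLe (S ++ t ∷ T ∷ʳ b)) (sym (++-assoc S (t + a ∷ T) (b ∷ [])))
        (PrefixLe-++ˡ S (m≤m+n t a ∷ PrefixLe-refl (T ∷ʳ b)))

PrefixLe-runs-factor : ∀ x u y →
  PrefixLe (proj₁ (runs x) ++ runsList (runs u)) (runsList (runs (x ++ u ++ y)))
PrefixLe-runs-factor x u y = PrefixLe-trans merged extended
  where
  S = proj₁ (runs x)
  merged : PrefixLe (S ++ runsList (runs u)) (runsList (runs (x ++ u)))
  merged = subst (λ X → PrefixLe (S ++ runsList (runs u)) (runsList X)) (sym (runs-++ x u))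
                 (PrefixLe-prependRuns S (proj₂ (runs x)) (runs u))
  runs-assoc : runsFrom (runs (x ++ u)) y ≡ runs (x ++ u ++ y)
  runs-assoc = trans (sym (foldl-++ _ ([] , 0) (x ++ u) y)) (cong runs (++-assoc x u y))
  extended : PrefixLe (runsList (runs (x ++ u))) (runsList (runs (x ++ u ++ y)))
  extended = subst (λ X → PrefixLe (runsList (runs (x ++ u))) (runsList X)) runs-assoc
                   (PrefixLe-runsFrom (runs (x ++ u)) y)

caterpillar-⪯ : ∀ S X Y → PrefixLe (S ++ runsList X) (runsList Y) → caterpillar X ⪯ caterpillar Y
caterpillar-⪯ S X Y p = ⪯-intro (length S) bound shifted
  where
  bound : length S + length (caterpillar X) ≤ length (caterpillar Y)
  bound = subst₂ _≤_ (trans (length-++ S) (cong (length S +_) (sym (length-caterpillar X))))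
                     (sym (length-caterpillar Y)) (PrefixLe-length p)
  shifted : PrefixLe (f (caterpillar X)) (drop (length S) (f (caterpillar Y)))
  shifted = subst₂ (λ xs ys → PrefixLe xs (drop (length S) ys))
                   (sym (f-caterpillar X)) (sym (f-caterpillar Y))
                   (subst (PrefixLe (map (2 +_) (runsList X))) (sym (drop-map (length S) (runsList Y)))
                          (PrefixLe-map (+-monoʳ-≤ 2) (PrefixLe-drop S p)))

lemma9 : (w u : List Bool) → Factor u w →
         (RC u ⪯ RC w) × (size (RC u) ≡ length u + 3) × (leaves (RC u) ≡ count1 u + 2)
lemma9 w u (x , y , refl) = RC-⪯ , size-RC u , leaves-RC u
  where
  RC-⪯ : RC u ⪯ RC (x ++ u ++ y)
  RC-⪯ = subst₂ _⪯_ (sym (RC-caterpillar u)) (sym (RC-caterpillar (x ++ u ++ y)))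
                (caterpillar-⪯ (proj₁ (runs x)) (runs u) (runs (x ++ u ++ y)) (PrefixLe-runs-factor x u y))
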